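{- Let $n$ be odd, let $a,b\in[n+2]$ with $a\ne b$, and let $w\in H_n$. Then either $\phi_{a,b}(w)\in H_{n+2}$, or the shape of $Q(\phi_{a,b}(w))$ is not symmetric.
   Context: Permutations are in one-line notation. $Q(w)$ is the recording tableau of $w$ under the Robinson–Schensted correspondence (Schensted row insertion). A shape is symmetric if it equals its transpose; a hook shape is of the form $(k,1^{m-k})$. $H_m=\{w\in\mathfrak{S}_m: Q(w)\text{ has symmetric hook shape}\}$. For $a\ne b$ in $[n+2]$, with $c=\min\{a,b\}$, $d=\max\{a,b\}$, $\phi_{a,b}:\mathfrak{S}_n\to\mathfrak{S}_{n+2}$ is defined by $\phi_{a,b}(w)_1=a$, $\phi_{a,b}(w)_{n+2}=b$, and for $i\in[n]$: $\phi_{a,b}(w)_{i+1}=w_i$ if $w_i<c$; $=w_i+1$ if $c\le w_i<d-1$; $=w_i+2$ if $d-1\le w_i$. -}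

module Defs where

open import Data.Nat using (ℕ; zero; suc; _+_; _*_; _∸_; _≤_; _<ᵇ_; _≤ᵇ_; _⊓_; _⊔_)
open import Data.Bool using (Bool; true; false; if_then_else_)
open import Data.List using (List; []; _∷_; _++_; [_]; map; length; filter; upTo; replicate; foldr)
open import Data.Maybe using (Maybe; just; nothing)
open import Data.Product using (_×_; _,_; proj₂; Σ; ∃)
open import Data.Nat using (_≤?_)
open import Data.List.Relation.Binary.Permutation.Propositional using (_↭_)
open import Relation.Binary.PropositionalEquality using (_≡_)

-- Permutations of [m] = {1,…,m} in one-line notation, as lists of naturals.
IsPerm : ℕ → List ℕ → Set
IsPerm m w = w ↭ map suc (upTo m)

-- A (semistandard) tableau as a list of rows (top row first).
Tableau : Set
Tableau = List (List ℕ)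

insertRow : ℕ → List ℕ → List ℕ × Maybe ℕ
insertRow x [] = [ x ] , nothing
insertRow x (y ∷ ys) with x <ᵇ y
... | true  = (x ∷ ys) , just y
... | false with insertRow x ys
...   | r , b = (y ∷ r) , b

-- Row insertion into a tableau; also returns the index (0-based) of the row
-- in which the new box was created.
insertT : ℕ → Tableau → Tableau × ℕ
insertT x [] = [ [ x ] ] , 0
insertT x (r ∷ rs) with insertRow x r
... | r' , nothing = (r' ∷ rs) , 0
... | r' , just y with insertT y rs
...   | rs' , i = (r' ∷ rs') , suc i

addAt : ℕ → ℕ → Tableau → Tableau
addAt k zero [] = [ [ k ] ]
addAt k zero (r ∷ rs) = (r ++ [ k ]) ∷ rs
addAt k (suc i) [] = [ [ k ] ]
addAt k (suc i) (r ∷ rs) = r ∷ addAt k i rs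

-- RS: insert w_1, w_2, … successively; step t (1-based) records t in Q.
rsAux : ℕ → List ℕ → Tableau → Tableau → Tableau × Tableau
rsAux t [] P Q = P , Q
rsAux t (x ∷ xs) P Q with insertT x P
... | P' , i = rsAux (suc t) xs P' (addAt t i Q)

RS : List ℕ → Tableau × Tableau
RS w = rsAux 1 w [] []

Qtab : List ℕ → Tableau
Qtab w = proj₂ (RS w)

shape : Tableau → List ℕ
shape = map length

conj : List ℕ → List ℕ
conj λs = map (λ j → length (filter (λ l → j ≤? l) λs)) (map suc (upTo (foldr _⊔_ 0 λs)))

Symmetric : List ℕ → Set
Symmetric sh = conj sh ≡ sh

Hook : ℕ → List ℕ → Set
Hook m sh = Σ ℕ λ k → (1 ≤ k) × (k ≤ m) × (sh ≡ k ∷ replicate (m ∸ k) 1)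

H : ℕ → List ℕ → Set
H m w = IsPerm m w × Hook m (shape (Qtab w)) × Symmetric (shape (Qtab w))

shiftφ : ℕ → ℕ → ℕ → ℕ
shiftφ c d x = if x <ᵇ c then x else (if x <ᵇ (d ∸ 1) then suc x else suc (suc x))

φ : ℕ → ℕ → List ℕ → List ℕ
φ a b w = a ∷ (map (shiftφ (a ⊓ b) (a ⊔ b)) w ++ [ b ])

Odd : ℕ → Set
Odd n = ∃ λ k → n ≡ suc (2 * k)

{-# OPTIONS --safe #-}
-- A symmetric hook (k, 1^(n-k)) has k = n - k + 1, so n + 2 = 2k + 1. The first row of Q(u) is
-- as long as the first row of Schensted's insertion tableau of u, which only depends on the
-- relative order of the letters of u. φ_{a,b} keeps the relative order of the letters of w, the
-- extra first letter a can only lower the entries of that row and the extra last letter b can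
-- only lengthen it, so the first row of Q(φ_{a,b}(w)) has at least k boxes. A self-conjugate
-- partition of 2k + 1 whose first part is at least k is the hook (k + 1, 1^k).
module Submission where

open import Defs
open import Data.Nat
open import Data.Nat.Properties
open import Data.Nat.ListAction using (sum)
open import Function using (_∘_)
open import Data.Nat.Tactic.RingSolver using (solve-∀)
open import Data.Bool using (true; false; if_then_else_; T)
open import Data.Unit using (tt; ⊤)
open import Data.Empty using (⊥; ⊥-elim)
open import Data.List using (List; []; _∷_; _++_; [_]; map; length; filter; upTo; replicate; foldr; applyUpTo)
open import Data.List.Properties
  using (∷-injectiveˡ; ∷-injectiveʳ; ≡-dec; filter-accept; filter-reject; length-map; length-upTo; length-replicate; length-++; map-++; ++-assoc; map-upTo)
open import Data.List.Relation.Unary.All using (All; []; _∷_)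
open import Data.List.Relation.Unary.All.Properties using (applyUpTo⁺₁) renaming (map⁺ to All-map⁺)
open import Data.List.Relation.Binary.Permutation.Propositional using (_↭_; prep; swap; ↭-refl; ↭-sym; module PermutationReasoning)
open import Data.List.Relation.Binary.Permutation.Propositional.Properties using (shift; ∷↭∷ʳ; ↭-length) renaming (map⁺ to ↭-map⁺)
open import Data.Maybe using (Maybe; just; nothing)
open import Data.Product using (_×_; _,_; proj₁; proj₂)
open import Data.Sum using (_⊎_; inj₁; inj₂)
open import Relation.Nullary using (¬_; yes; no)
open import Relation.Binary.Definitions using (tri<; tri≈; tri>)
open import Relation.Binary.PropositionalEquality hiding ([_])

<ᵇ≡true⇒< : ∀ {x y} → (x <ᵇ y) ≡ true → x < y
<ᵇ≡true⇒< {x} {y} e = <ᵇ⇒< x y (subst T (sym e) tt)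

<ᵇ≡false⇒≥ : ∀ {x y} → (x <ᵇ y) ≡ false → y ≤ x
<ᵇ≡false⇒≥ e = ≮⇒≥ (λ x<y → subst T e (<⇒<ᵇ x<y))

<⇒<ᵇ≡true : ∀ {x y} → x < y → (x <ᵇ y) ≡ true
<⇒<ᵇ≡true {x} {y} x<y with x <ᵇ y in e
... | true  = refl
... | false = ⊥-elim (<⇒≱ x<y (<ᵇ≡false⇒≥ e))

≥⇒<ᵇ≡false : ∀ {x y} → y ≤ x → (x <ᵇ y) ≡ false
≥⇒<ᵇ≡false {x} {y} y≤x with x <ᵇ y in e
... | false = refl
... | true  = ⊥-elim (<⇒≱ (<ᵇ≡true⇒< e) y≤x)

rowInsert : ℕ → List ℕ → List ℕ
rowInsert x [] = [ x ]
rowInsert x (y ∷ ys) = if x <ᵇ y then x ∷ ys else y ∷ rowInsert x ys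

proj₁-insertRow : ∀ x r → proj₁ (insertRow x r) ≡ rowInsert x r
proj₁-insertRow x [] = refl
proj₁-insertRow x (y ∷ ys) with x <ᵇ y
... | true = refl
... | false with insertRow x ys in e
... | r , _ = cong (y ∷_) (trans (cong proj₁ (sym e)) (proj₁-insertRow x ys))

rowInsertAll : List ℕ → List ℕ → List ℕ
rowInsertAll [] r = r
rowInsertAll (x ∷ xs) r = rowInsertAll xs (rowInsert x r)

rowInsertAll-++ : ∀ xs ys r → rowInsertAll (xs ++ ys) r ≡ rowInsertAll ys (rowInsertAll xs r)
rowInsertAll-++ [] ys r = refl
rowInsertAll-++ (x ∷ xs) ys r = rowInsertAll-++ xs ys (rowInsert x r)

infix 4 _≼_

_≼_ : List ℕ → List ℕ → Set
_ ≼ [] = ⊤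
[] ≼ (_ ∷ _) = ⊥
(x ∷ r) ≼ (y ∷ s) = x ≤ y × r ≼ s

≼-refl : ∀ r → r ≼ r
≼-refl [] = tt
≼-refl (x ∷ r) = ≤-refl , ≼-refl r

≼-trans : ∀ r s u → r ≼ s → s ≼ u → r ≼ u
≼-trans r s [] _ _ = tt
≼-trans [] (_ ∷ _) (_ ∷ _) () _
≼-trans (x ∷ r) (y ∷ s) (z ∷ u) (x≤y , r≼s) (y≤z , s≼u) = ≤-trans x≤y y≤z , ≼-trans r s u r≼s s≼u

≼⇒length≥ : ∀ r s → r ≼ s → length s ≤ length r
≼⇒length≥ r [] _ = z≤n
≼⇒length≥ (x ∷ r) (y ∷ s) (_ , r≼s) = s≤s (≼⇒length≥ r s r≼s)

rowInsert-≼ : ∀ x r → rowInsert x r ≼ r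
rowInsert-≼ x [] = tt
rowInsert-≼ x (y ∷ ys) with x <ᵇ y in e
... | true  = <⇒≤ (<ᵇ≡true⇒< e) , ≼-refl ys
... | false = ≤-refl , rowInsert-≼ x ys

rowInsert-mono-≼ : ∀ x r s → r ≼ s → rowInsert x r ≼ rowInsert x s
rowInsert-mono-≼ x [] [] _ = ≤-refl , tt
rowInsert-mono-≼ x (y ∷ ys) [] _ with x <ᵇ y in e
... | true  = ≤-refl , tt
... | false = <ᵇ≡false⇒≥ e , tt
rowInsert-mono-≼ x (y ∷ ys) (z ∷ zs) (y≤z , ys≼zs) with x <ᵇ y in e | x <ᵇ z in e'
... | true  | true  = ≤-refl , ys≼zs
... | true  | false = ⊥-elim (<⇒≱ (<ᵇ≡true⇒< e) (≤-trans y≤z (<ᵇ≡false⇒≥ e')))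
... | false | true  = <ᵇ≡false⇒≥ e , ≼-trans (rowInsert x ys) ys zs (rowInsert-≼ x ys) ys≼zs
... | false | false = y≤z , rowInsert-mono-≼ x ys zs ys≼zs

rowInsertAll-mono-≼ : ∀ xs r s → r ≼ s → rowInsertAll xs r ≼ rowInsertAll xs s
rowInsertAll-mono-≼ [] r s r≼s = r≼s
rowInsertAll-mono-≼ (x ∷ xs) r s r≼s = rowInsertAll-mono-≼ xs _ _ (rowInsert-mono-≼ x r s r≼s)

module StrictlyIncreasing (f : ℕ → ℕ) (f-< : ∀ {x y} → x < y → f x < f y) where

  f-<ᵇ : ∀ x y → (f x <ᵇ f y) ≡ (x <ᵇ y)
  f-<ᵇ x y with x <ᵇ y in e
  ... | true  = <⇒<ᵇ≡true (f-< (<ᵇ≡true⇒< e))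
  ... | false with m≤n⇒m<n∨m≡n (<ᵇ≡false⇒≥ {x} {y} e)
  ...   | inj₁ y<x  = ≥⇒<ᵇ≡false (<⇒≤ (f-< y<x))
  ...   | inj₂ y≡x = ≥⇒<ᵇ≡false {f x} {f y} (≤-reflexive (cong f y≡x))

  rowInsert-map : ∀ x r → rowInsert (f x) (map f r) ≡ map f (rowInsert x r)
  rowInsert-map x [] = refl
  rowInsert-map x (y ∷ ys) rewrite f-<ᵇ x y with x <ᵇ y
  ... | true  = refl
  ... | false = cong (f y ∷_) (rowInsert-map x ys)

  rowInsertAll-map : ∀ xs r → rowInsertAll (map f xs) (map f r) ≡ map f (rowInsertAll xs r)
  rowInsertAll-map [] r = refl
  rowInsertAll-map (x ∷ xs) r = trans (cong (rowInsertAll (map f xs)) (rowInsert-map x r)) (rowInsertAll-map xs (rowInsert x r))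

  length-rowInsertAll-surround : ∀ a b w →
    length (rowInsertAll w []) ≤ length (rowInsertAll (a ∷ map f w ++ [ b ]) [])
  length-rowInsertAll-surround a b w = begin
      length (rowInsertAll w [])
    ≡⟨ sym (length-map f (rowInsertAll w [])) ⟩
      length (map f (rowInsertAll w []))
    ≡⟨ cong length (sym (rowInsertAll-map w [])) ⟩
      length (rowInsertAll (map f w) [])
    ≤⟨ ≼⇒length≥ (rowInsertAll (map f w) [ a ]) (rowInsertAll (map f w) []) (rowInsertAll-mono-≼ (map f w) [ a ] [] tt) ⟩
      length (rowInsertAll (map f w) [ a ])
    ≤⟨ ≼⇒length≥ (rowInsert b (rowInsertAll (map f w) [ a ])) (rowInsertAll (map f w) [ a ]) (rowInsert-≼ b _) ⟩
      length (rowInsert b (rowInsertAll (map f w) [ a ]))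
    ≡⟨ cong length (sym (rowInsertAll-++ (map f w) [ b ] [ a ])) ⟩
      length (rowInsertAll (a ∷ map f w ++ [ b ]) [])
    ∎ where open ≤-Reasoning

firstRow : Tableau → List ℕ
firstRow [] = []
firstRow (r ∷ _) = r

firstRow-insertT : ∀ x P → firstRow (proj₁ (insertT x P)) ≡ rowInsert x (firstRow P)
firstRow-insertT x [] = refl
firstRow-insertT x (r ∷ rs) with insertRow x r in e
... | r' , nothing = trans (cong proj₁ (sym e)) (proj₁-insertRow x r)
... | r' , just y with insertT y rs
... | _ = trans (cong proj₁ (sym e)) (proj₁-insertRow x r)

data RowGrowth (r : List ℕ) : List ℕ × Maybe ℕ → Set where
  grows : ∀ r' → length r' ≡ suc (length r) → RowGrowth r (r' , nothing)
  bumps : ∀ r' y → length r' ≡ length r → RowGrowth r (r' , just y)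

rowGrowth : ∀ x r → RowGrowth r (insertRow x r)
rowGrowth x [] = grows _ refl
rowGrowth x (y ∷ ys) with x <ᵇ y
... | true = bumps _ _ refl
... | false with insertRow x ys | rowGrowth x ys
... | _ | grows r' p = grows _ (cong suc p)
... | _ | bumps r' z p = bumps _ _ (cong suc p)

length-∷ʳ : ∀ (q : List ℕ) t → length (q ++ [ t ]) ≡ suc (length q)
length-∷ʳ q t = trans (length-++ q) (+-comm (length q) 1)

length-firstRow-insert-addAt : ∀ x t P Q → length (firstRow P) ≡ length (firstRow Q) →
  length (firstRow (proj₁ (insertT x P))) ≡ length (firstRow (addAt t (proj₂ (insertT x P)) Q))
length-firstRow-insert-addAt x t [] [] _ = refl
length-firstRow-insert-addAt x t [] (q ∷ Q) h = trans (cong suc h) (sym (length-∷ʳ q t))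
length-firstRow-insert-addAt x t ([] ∷ rs) [] _ = refl
length-firstRow-insert-addAt x t ([] ∷ rs) (q ∷ qs) h = trans (cong suc h) (sym (length-∷ʳ q t))
length-firstRow-insert-addAt x t ((y ∷ r) ∷ rs) Q h with insertRow x (y ∷ r) | rowGrowth x (y ∷ r)
... | _ | grows r' p with Q
...   | [] = trans p (cong suc h)
...   | q ∷ qs = trans p (trans (cong suc h) (sym (length-∷ʳ q t)))
length-firstRow-insert-addAt x t ((y ∷ r) ∷ rs) Q h | _ | bumps r' z p with insertT z rs
... | _ with Q
...   | q ∷ qs = trans p h
...   | [] = ⊥-elim (1+n≢0 h)

length-firstRow-rsAux : ∀ t xs P Q → length (firstRow P) ≡ length (firstRow Q) →
  length (firstRow (proj₂ (rsAux t xs P Q))) ≡ length (rowInsertAll xs (firstRow P))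
length-firstRow-rsAux t [] P Q h = sym h
length-firstRow-rsAux t (x ∷ xs) P Q h with insertT x P in e
... | P' , i = trans (length-firstRow-rsAux (suc t) xs P' (addAt t i Q) invariant)
                     (cong (λ r → length (rowInsertAll xs r)) firstRow-P')
  where
  firstRow-P' : firstRow P' ≡ rowInsert x (firstRow P)
  firstRow-P' = trans (cong (λ p → firstRow (proj₁ p)) (sym e)) (firstRow-insertT x P)
  invariant : length (firstRow P') ≡ length (firstRow (addAt t i Q))
  invariant = subst (λ p → length (firstRow (proj₁ p)) ≡ length (firstRow (addAt t (proj₂ p) Q)))
                    e (length-firstRow-insert-addAt x t P Q h)

length-firstRow-Qtab : ∀ w → length (firstRow (Qtab w)) ≡ length (rowInsertAll w [])
length-firstRow-Qtab w = length-firstRow-rsAux 1 w [] [] refl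

size-addAt : ∀ k i Q → sum (shape (addAt k i Q)) ≡ suc (sum (shape Q))
size-addAt k zero [] = refl
size-addAt k zero (r ∷ rs) = cong (_+ sum (shape rs)) (length-∷ʳ r k)
size-addAt k (suc i) [] = refl
size-addAt k (suc i) (r ∷ rs) = trans (cong (length r +_) (size-addAt k i rs)) (+-suc (length r) _)

size-rsAux : ∀ t xs P Q → sum (shape (proj₂ (rsAux t xs P Q))) ≡ length xs + sum (shape Q)
size-rsAux t [] P Q = refl
size-rsAux t (x ∷ xs) P Q with insertT x P
... | P' , i = trans (size-rsAux (suc t) xs P' (addAt t i Q))
                     (trans (cong (length xs +_) (size-addAt t i Q)) (+-suc (length xs) _))

size-Qtab : ∀ w → sum (shape (Qtab w)) ≡ length w
size-Qtab w = trans (size-rsAux 1 w [] []) (+-identityʳ (length w))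

shiftφ-offset : ℕ → ℕ → ℕ → ℕ
shiftφ-offset c d x = if x <ᵇ c then 0 else (if x <ᵇ (d ∸ 1) then 1 else 2)

shiftφ≡+offset : ∀ c d x → shiftφ c d x ≡ x + shiftφ-offset c d x
shiftφ≡+offset c d x with x <ᵇ c
... | true = sym (+-identityʳ x)
... | false with x <ᵇ (d ∸ 1)
...   | true = +-comm 1 x
...   | false = +-comm 2 x

shiftφ-offset-mono : ∀ c d {x y} → x ≤ y → shiftφ-offset c d x ≤ shiftφ-offset c d y
shiftφ-offset-mono c d {x} {y} x≤y with x <ᵇ c in e
... | true = z≤n
... | false rewrite ≥⇒<ᵇ≡false {y} {c} (≤-trans (<ᵇ≡false⇒≥ e) x≤y) with x <ᵇ (d ∸ 1) in e'
...   | true with y <ᵇ (d ∸ 1)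
...     | true = ≤-refl
...     | false = s≤s z≤n
shiftφ-offset-mono c d {x} {y} x≤y | false | false
  rewrite ≥⇒<ᵇ≡false {y} {d ∸ 1} (≤-trans (<ᵇ≡false⇒≥ e') x≤y) = ≤-refl

shiftφ-< : ∀ c d {x y} → x < y → shiftφ c d x < shiftφ c d y
shiftφ-< c d {x} {y} x<y rewrite shiftφ≡+offset c d x | shiftφ≡+offset c d y =
  +-mono-<-≤ x<y (shiftφ-offset-mono c d (<⇒≤ x<y))

length-firstRow-Qtab-φ : ∀ a b w → length (firstRow (Qtab w)) ≤ length (firstRow (Qtab (φ a b w)))
length-firstRow-Qtab-φ a b w
  rewrite length-firstRow-Qtab w | length-firstRow-Qtab (φ a b w) =
  length-rowInsertAll-surround a b w
  where open StrictlyIncreasing (shiftφ (a ⊓ b) (a ⊔ b)) (shiftφ-< (a ⊓ b) (a ⊔ b))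

length-φ : ∀ a b w → length (φ a b w) ≡ length w + 2
length-φ a b w = begin
    suc (length (map f w ++ [ b ]))
  ≡⟨ cong suc (length-∷ʳ (map f w) b) ⟩
    suc (suc (length (map f w)))
  ≡⟨ cong (λ l → suc (suc l)) (length-map f w) ⟩
    suc (suc (length w))
  ≡⟨ +-comm 2 (length w) ⟩
    length w + 2
  ∎
  where
  f = shiftφ (a ⊓ b) (a ⊔ b)
  open ≡-Reasoning

interval : ℕ → ℕ → List ℕ
interval s zero = []
interval s (suc l) = s ∷ interval (suc s) l

interval-++ : ∀ s l m → interval s (l + m) ≡ interval s l ++ interval (s + l) m
interval-++ s zero m = cong (λ z → interval z m) (sym (+-identityʳ s))
interval-++ s (suc l) m =
  cong (s ∷_) (trans (interval-++ (suc s) l m) (cong (λ z → interval (suc s) l ++ interval z m) (sym (+-suc s l))))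

applyUpTo≡interval : ∀ (g : ℕ → ℕ) s n → (∀ i → g i ≡ s + i) → applyUpTo g n ≡ interval s n
applyUpTo≡interval g s zero _ = refl
applyUpTo≡interval g s (suc n) g≡ =
  cong₂ _∷_ (trans (g≡ 0) (+-identityʳ s)) (applyUpTo≡interval (g ∘ suc) (suc s) n (λ i → trans (g≡ (suc i)) (+-suc s i)))

upTo≡interval : ∀ n → map suc (upTo n) ≡ interval 1 n
upTo≡interval n = trans (map-upTo suc n) (applyUpTo≡interval suc 1 n (λ _ → refl))

map-interval : ∀ (f : ℕ → ℕ) δ s l → (∀ x → s ≤ x → x < s + l → f x ≡ δ + x) →
  map f (interval s l) ≡ interval (δ + s) l
map-interval f δ s zero _ = refl
map-interval f δ s (suc l) f≡ = cong₂ _∷_ (f≡ s ≤-refl (m<m+n s z<s))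
  (trans (map-interval f δ (suc s) l (λ x s<x x<s+l → f≡ x (<⇒≤ s<x) (subst (x <_) (sym (+-suc s l)) x<s+l)))
         (cong (λ z → interval z l) (+-suc δ s)))

insert-two-↭ : ∀ (c d : ℕ) A B C → c ∷ d ∷ (A ++ B ++ C) ↭ A ++ c ∷ (B ++ d ∷ C)
insert-two-↭ c d A B C = begin
    c ∷ d ∷ (A ++ B ++ C)
  ≡⟨ cong (λ z → c ∷ d ∷ z) (sym (++-assoc A B C)) ⟩
    c ∷ d ∷ ((A ++ B) ++ C)
  ↭⟨ prep c (↭-sym (shift d (A ++ B) C)) ⟩
    c ∷ ((A ++ B) ++ d ∷ C)
  ≡⟨ cong (c ∷_) (++-assoc A B (d ∷ C)) ⟩
    c ∷ (A ++ B ++ d ∷ C)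
  ↭⟨ ↭-sym (shift c A (B ++ d ∷ C)) ⟩
    A ++ c ∷ (B ++ d ∷ C)
  ∎ where open PermutationReasoning

-- With c = l₁ + 1 and d = c + l₂ + 1, φ sends the blocks [1, c), [c, d - 1) and [d - 1, n] of
-- [1, n] onto the blocks of [1, n + 2] left when c and d are removed.
map-shiftφ-interval : ∀ l₁ l₂ l₃ → let c = suc l₁ ; d = suc c + l₂ in
  map (shiftφ c d) (interval 1 (l₁ + (l₂ + l₃))) ≡ interval 1 l₁ ++ interval (suc c) l₂ ++ interval (suc d) l₃
map-shiftφ-interval l₁ l₂ l₃ = begin
    map f (interval 1 (l₁ + (l₂ + l₃)))
  ≡⟨ cong (map f) (trans (interval-++ 1 l₁ (l₂ + l₃)) (cong (interval 1 l₁ ++_) (interval-++ c l₂ l₃))) ⟩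
    map f (interval 1 l₁ ++ interval c l₂ ++ interval (c + l₂) l₃)
  ≡⟨ trans (map-++ f (interval 1 l₁) _) (cong (map f (interval 1 l₁) ++_) (map-++ f (interval c l₂) _)) ⟩
    map f (interval 1 l₁) ++ map f (interval c l₂) ++ map f (interval (c + l₂) l₃)
  ≡⟨ cong₂ _++_ (map-interval f 0 1 l₁ first)
       (cong₂ _++_ (map-interval f 1 c l₂ middle) (map-interval f 2 (c + l₂) l₃ last)) ⟩
    interval 1 l₁ ++ interval (suc c) l₂ ++ interval (suc (suc c + l₂)) l₃
  ∎
  where
  open ≡-Reasoning
  c = suc l₁
  f = shiftφ c (suc c + l₂)
  first : ∀ x → 1 ≤ x → x < 1 + l₁ → f x ≡ 0 + x
  first x _ x<c rewrite <⇒<ᵇ≡true {x} {c} x<c = refl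
  middle : ∀ x → c ≤ x → x < c + l₂ → f x ≡ 1 + x
  middle x c≤x x<d-1 rewrite ≥⇒<ᵇ≡false {x} {c} c≤x | <⇒<ᵇ≡true {x} {c + l₂} x<d-1 = refl
  last : ∀ x → c + l₂ ≤ x → x < c + l₂ + l₃ → f x ≡ 2 + x
  last x d-1≤x _ rewrite ≥⇒<ᵇ≡false {x} {c} (≤-trans (m≤m+n c l₂) d-1≤x) | ≥⇒<ᵇ≡false {x} {c + l₂} d-1≤x = refl

shiftφ-interval-↭ : ∀ l₁ l₂ l₃ → let c = suc l₁ ; d = suc c + l₂ in
  c ∷ d ∷ map (shiftφ c d) (interval 1 (l₁ + (l₂ + l₃))) ↭ interval 1 (l₁ + suc (l₂ + suc l₃))
shiftφ-interval-↭ l₁ l₂ l₃ = begin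
    c ∷ d ∷ map (shiftφ c d) (interval 1 (l₁ + (l₂ + l₃)))
  ≡⟨ cong (λ z → c ∷ d ∷ z) (map-shiftφ-interval l₁ l₂ l₃) ⟩
    c ∷ d ∷ (A ++ B ++ C)
  ↭⟨ insert-two-↭ c d A B C ⟩
    A ++ c ∷ (B ++ d ∷ C)
  ≡⟨ sym (trans (interval-++ 1 l₁ _) (cong (λ z → A ++ c ∷ z) (interval-++ (suc c) l₂ (suc l₃)))) ⟩
    interval 1 (l₁ + suc (l₂ + suc l₃))
  ∎
  where
  open PermutationReasoning
  c = suc l₁
  d = suc c + l₂
  A = interval 1 l₁
  B = interval (suc c) l₂
  C = interval (suc d) l₃

φ-sorted-↭ : ∀ c d n (w : List ℕ) → 1 ≤ c → c < d → d ≤ n + 2 → IsPerm n w →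
  c ∷ d ∷ map (shiftφ c d) w ↭ map suc (upTo (n + 2))
φ-sorted-↭ (suc l₁) d n w _ c<d d≤n+2 w↭ with m≤n⇒∃[o]m+o≡n c<d
... | l₂ , refl with m≤n⇒∃[o]m+o≡n d≤n+2
... | l₃ , d+l₃≡n+2 = begin
    c ∷ d ∷ map f w
  ↭⟨ prep c (prep d (↭-map⁺ f w↭)) ⟩
    c ∷ d ∷ map f (map suc (upTo n))
  ≡⟨ cong (λ z → c ∷ d ∷ map f z) (trans (upTo≡interval n) (cong (interval 1) n≡)) ⟩
    c ∷ d ∷ map f (interval 1 (l₁ + (l₂ + l₃)))
  ↭⟨ shiftφ-interval-↭ l₁ l₂ l₃ ⟩
    interval 1 (l₁ + suc (l₂ + suc l₃))
  ≡⟨ cong (interval 1) n+2≡ ⟩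
    interval 1 (n + 2)
  ≡⟨ sym (upTo≡interval (n + 2)) ⟩
    map suc (upTo (n + 2))
  ∎
  where
  open PermutationReasoning
  c = suc l₁
  f = shiftφ c (suc c + l₂)
  n+2≡ : l₁ + suc (l₂ + suc l₃) ≡ n + 2
  n+2≡ = trans (regroup l₁ l₂ l₃) d+l₃≡n+2
    where
    regroup : ∀ l₁ l₂ l₃ → l₁ + suc (l₂ + suc l₃) ≡ suc (suc l₁) + l₂ + l₃
    regroup = solve-∀
  n≡ : n ≡ l₁ + (l₂ + l₃)
  n≡ = +-cancelʳ-≡ 2 n _ (trans (sym n+2≡) (regroup l₁ l₂ l₃))
    where
    regroup : ∀ l₁ l₂ l₃ → l₁ + suc (l₂ + suc l₃) ≡ l₁ + (l₂ + l₃) + 2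
    regroup = solve-∀

φ-isPerm : ∀ n a b w → 1 ≤ a → a ≤ n + 2 → 1 ≤ b → b ≤ n + 2 → a ≢ b → IsPerm n w → IsPerm (n + 2) (φ a b w)
φ-isPerm n a b w 1≤a a≤n+2 1≤b b≤n+2 a≢b w↭ with <-cmp a b
... | tri≈ _ a≡b _ = ⊥-elim (a≢b a≡b)
... | tri< a<b _ _ rewrite m≤n⇒m⊓n≡m (<⇒≤ a<b) | m≤n⇒m⊔n≡n (<⇒≤ a<b) = begin
    a ∷ (map (shiftφ a b) w ++ [ b ])
  ↭⟨ prep a (↭-sym (∷↭∷ʳ b _)) ⟩
    a ∷ b ∷ map (shiftφ a b) w
  ↭⟨ φ-sorted-↭ a b n w 1≤a a<b b≤n+2 w↭ ⟩
    map suc (upTo (n + 2))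
  ∎ where open PermutationReasoning
... | tri> _ _ b<a rewrite m≥n⇒m⊓n≡n (<⇒≤ b<a) | m≥n⇒m⊔n≡m (<⇒≤ b<a) = begin
    a ∷ (map (shiftφ b a) w ++ [ b ])
  ↭⟨ prep a (↭-sym (∷↭∷ʳ b _)) ⟩
    a ∷ b ∷ map (shiftφ b a) w
  ↭⟨ swap a b ↭-refl ⟩
    b ∷ a ∷ map (shiftφ b a) w
  ↭⟨ φ-sorted-↭ b a n w 1≤b b<a a≤n+2 w↭ ⟩
    map suc (upTo (n + 2))
  ∎ where open PermutationReasoning

IsPerm⇒length : ∀ {n} w → IsPerm n w → length w ≡ n
IsPerm⇒length {n} w w↭ = trans (↭-length w↭) (trans (length-map suc (upTo n)) (length-upTo n))

count≥ : ℕ → List ℕ → ℕ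
count≥ j λs = length (filter (j ≤?_) λs)

-- conj λs reduces to columns λs (foldr _⊔_ 0 λs).
columns : List ℕ → ℕ → List ℕ
columns λs M = map (λ j → count≥ j λs) (map suc (upTo M))

count≥-∷-≤ : ∀ {j x} xs → j ≤ x → count≥ j (x ∷ xs) ≡ suc (count≥ j xs)
count≥-∷-≤ {j} xs j≤x = cong length (filter-accept (j ≤?_) j≤x)

count≥-∷-≰ : ∀ {j x} xs → ¬ j ≤ x → count≥ j (x ∷ xs) ≡ count≥ j xs
count≥-∷-≰ {j} xs j≰x = cong length (filter-reject (j ≤?_) j≰x)

count≥-positive : ∀ j λs → 1 ≤ j → j ≤ foldr _⊔_ 0 λs → 1 ≤ count≥ j λs
count≥-positive (suc j) [] _ ()
count≥-positive j (x ∷ xs) 1≤j j≤max with j ≤? x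
... | yes j≤x rewrite count≥-∷-≤ xs j≤x = s≤s z≤n
... | no j≰x rewrite count≥-∷-≰ xs j≰x with ≤-total x (foldr _⊔_ 0 xs)
...   | inj₁ x≤ = count≥-positive j xs 1≤j (subst (j ≤_) (m≤n⇒m⊔n≡n x≤) j≤max)
...   | inj₂ ≥x = ⊥-elim (j≰x (subst (j ≤_) (m≥n⇒m⊔n≡m ≥x) j≤max))

count≥1≡length : ∀ λs → All (1 ≤_) λs → count≥ 1 λs ≡ length λs
count≥1≡length [] [] = refl
count≥1≡length (suc x ∷ xs) (_ ∷ pos) = cong suc (count≥1≡length xs pos)

conj-positive : ∀ λs → All (1 ≤_) (conj λs)
conj-positive λs = All-map⁺ (All-map⁺ (applyUpTo⁺₁ _ (foldr _⊔_ 0 λs)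
  (λ {i} i<max → count≥-positive (suc i) λs (s≤s z≤n) i<max)))

length-conj : ∀ λs → length (conj λs) ≡ foldr _⊔_ 0 λs
length-conj λs = trans (length-map _ (map suc (upTo M))) (trans (length-map suc (upTo M)) (length-upTo M))
  where M = foldr _⊔_ 0 λs

symmetric⇒positive : ∀ {λs} → Symmetric λs → All (1 ≤_) λs
symmetric⇒positive {λs} s = subst (All (1 ≤_)) s (conj-positive λs)

symmetric⇒tail-positive : ∀ {h t} → Symmetric (h ∷ t) → All (1 ≤_) t
symmetric⇒tail-positive s with symmetric⇒positive s
... | _ ∷ pos = pos

symmetric⇒max≡length : ∀ {λs} → Symmetric λs → foldr _⊔_ 0 λs ≡ length λs
symmetric⇒max≡length {λs} s = trans (sym (length-conj λs)) (cong length s)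

symmetric⇒≡columns : ∀ {λs} → Symmetric λs → λs ≡ columns λs (length λs)
symmetric⇒≡columns {λs} s = trans (sym s) (cong (columns λs) (symmetric⇒max≡length s))

symmetric⇒head≡length : ∀ h t → Symmetric (h ∷ t) → h ≡ suc (length t)
symmetric⇒head≡length h t s = begin
    h
  ≡⟨ ∷-injectiveˡ (symmetric⇒≡columns s) ⟩
    count≥ 1 (h ∷ t)
  ≡⟨ count≥1≡length (h ∷ t) (symmetric⇒positive s) ⟩
    suc (length t)
  ∎ where open ≡-Reasoning

symmetric⇒second≡count≥2 : ∀ h x u → Symmetric (h ∷ x ∷ u) → x ≡ count≥ 2 (h ∷ x ∷ u)
symmetric⇒second≡count≥2 h x u s = ∷-injectiveˡ (∷-injectiveʳ (symmetric⇒≡columns s))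

length+count≥2≤sum : ∀ u → All (1 ≤_) u → length u + count≥ 2 u ≤ sum u
length+count≥2≤sum [] [] = z≤n
length+count≥2≤sum (suc zero ∷ u) (_ ∷ pos) = s≤s (length+count≥2≤sum u pos)
length+count≥2≤sum (suc (suc y) ∷ u) (_ ∷ pos) = s≤s (begin
    length u + suc (count≥ 2 u)
  ≡⟨ +-suc (length u) _ ⟩
    suc (length u + count≥ 2 u)
  ≤⟨ s≤s (length+count≥2≤sum u pos) ⟩
    suc (sum u)
  ≤⟨ s≤s (m≤n+m (sum u) y) ⟩
    suc (y + sum u)
  ∎) where open ≤-Reasoning

length≤sum : ∀ u → All (1 ≤_) u → length u ≤ sum u
length≤sum u pos = ≤-trans (m≤m+n (length u) _) (length+count≥2≤sum u pos)

count≥2≡0⇒sum≡length : ∀ u → All (1 ≤_) u → count≥ 2 u ≡ 0 → sum u ≡ length u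
count≥2≡0⇒sum≡length [] [] _ = refl
count≥2≡0⇒sum≡length (suc zero ∷ u) (_ ∷ pos) c≡0 = cong suc (count≥2≡0⇒sum≡length u pos c≡0)
count≥2≡0⇒sum≡length (suc (suc y) ∷ u) (_ ∷ pos) ()

sum≡length⇒ones : ∀ t → All (1 ≤_) t → sum t ≡ length t → t ≡ replicate (length t) 1
sum≡length⇒ones [] [] _ = refl
sum≡length⇒ones (suc zero ∷ t) (_ ∷ pos) e = cong (1 ∷_) (sum≡length⇒ones t pos (suc-injective e))
sum≡length⇒ones (suc (suc y) ∷ t) (_ ∷ pos) e =
  ⊥-elim (<⇒≱ (≤-reflexive (suc-injective e)) (≤-trans (length≤sum t pos) (m≤n+m (sum t) y)))

-- The excess sum − length of x ∷ u is 0 if x = 1, 1 if x = 2, and at least 2x − 3 ≥ 3 otherwise.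
¬excess-two : ∀ x u → All (1 ≤_) (x ∷ u) → x ≡ suc (count≥ 2 (x ∷ u)) → sum (x ∷ u) ≢ 2 + length (x ∷ u)
¬excess-two (suc zero) u (_ ∷ pos) x≡ sum≡ =
  m≢1+n+m (length u) (trans (sym (count≥2≡0⇒sum≡length u pos (sym (suc-injective x≡)))) (suc-injective sum≡))
¬excess-two (suc (suc zero)) u (_ ∷ pos) x≡ sum≡ =
  m≢1+n+m (length u) (trans (sym (count≥2≡0⇒sum≡length u pos (sym (suc-injective (suc-injective x≡)))))
                            (suc-injective (suc-injective sum≡)))
¬excess-two (suc (suc (suc y))) u (_ ∷ pos) x≡ sum≡ = <-irrefl refl (begin-strict
    suc (length u)
  <⟨ m<n+m (suc (length u)) z<s ⟩
    suc y + suc (length u)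
  ≤⟨ +-monoʳ-≤ (suc y) (≤-trans (m<m+n (length u) z<s) (subst (λ c → length u + c ≤ sum u) (sym y≡) (length+count≥2≤sum u pos))) ⟩
    suc y + sum u
  ≡⟨ suc-injective (suc-injective sum≡) ⟩
    suc (length u)
  ∎)
  where
  open ≤-Reasoning
  y≡ : suc y ≡ count≥ 2 u
  y≡ = suc-injective (suc-injective x≡)

m+m≤n+n⇒m≤n : ∀ m n → m + m ≤ n + n → m ≤ n
m+m≤n+n⇒m≤n m n m+m≤n+n with m ≤? n
... | yes m≤n = m≤n
... | no m≰n = ⊥-elim (<⇒≱ (+-mono-< (≰⇒> m≰n) (≰⇒> m≰n)) m+m≤n+n)

¬selfConjugate-excess-two : ∀ t → Symmetric (suc (length t) ∷ t) → sum t ≢ 2 + length t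
¬selfConjugate-excess-two [] _ ()
¬selfConjugate-excess-two (x ∷ u) s = ¬excess-two x u (symmetric⇒tail-positive {suc (length (x ∷ u))} s)
  (trans (symmetric⇒second≡count≥2 (suc (length (x ∷ u))) x u s) (count≥-∷-≤ {2} {suc (length (x ∷ u))} (x ∷ u) (s≤s (s≤s z≤n))))

selfConjugate-firstPart≥⇒hook : ∀ K h t → Symmetric (h ∷ t) → sum (h ∷ t) ≡ suc (K + K) → K ≤ h →
  h ∷ t ≡ suc K ∷ replicate K 1
selfConjugate-firstPart≥⇒hook K h t s size K≤h with symmetric⇒head≡length h t s
... | refl with m≤n⇒m<n∨m≡n L≤K
  where
  L = length t
  L≤K : L ≤ K
  L≤K = m+m≤n+n⇒m≤n L K (≤-trans (+-monoʳ-≤ L (length≤sum t (symmetric⇒tail-positive s)))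
                                  (≤-reflexive (suc-injective size)))
...   | inj₂ refl =
  cong (suc K ∷_) (sum≡length⇒ones t (symmetric⇒tail-positive s) (+-cancelˡ-≡ K _ _ (suc-injective size)))
...   | inj₁ L<K with ≤-antisym K≤h L<K
...     | refl = ⊥-elim (¬selfConjugate-excess-two t s
                   (+-cancelˡ-≡ (suc L) _ _ (trans size (cong suc (sym (+-suc L (suc L)))))))
  where L = length t

symmetric-shape⇒hook : ∀ K Q → Symmetric (shape Q) → sum (shape Q) ≡ suc (K + K) → K ≤ length (firstRow Q) →
  shape Q ≡ suc K ∷ replicate K 1
symmetric-shape⇒hook K [] _ ()
symmetric-shape⇒hook K (q ∷ Q) = selfConjugate-firstPart≥⇒hook K (length q) (shape Q)

length-firstRow≡head : ∀ Q {h t} → shape Q ≡ h ∷ t → length (firstRow Q) ≡ h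
length-firstRow≡head (q ∷ Q) e = ∷-injectiveˡ e

hook-shape : ∀ k → Hook (suc (k + k)) (suc k ∷ replicate k 1)
hook-shape k = suc k , s≤s z≤n , s≤s (m≤m+n k k) , cong (λ m → suc k ∷ replicate m 1) (sym (m+n∸m≡n k k))

symmetricHook⇒k+k≡1+n : ∀ n k → k ≤ n → Symmetric (k ∷ replicate (n ∸ k) 1) → k + k ≡ suc n
symmetricHook⇒k+k≡1+n n k k≤n s = begin
    k + k
  ≡⟨ cong (k +_) (trans (symmetric⇒head≡length k _ s) (cong suc (length-replicate (n ∸ k)))) ⟩
    k + suc (n ∸ k)
  ≡⟨ +-suc k (n ∸ k) ⟩
    suc (k + (n ∸ k))
  ≡⟨ cong suc (m+[n∸m]≡n k≤n) ⟩
    suc n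
  ∎ where open ≡-Reasoning

lemma3p10 : (n : ℕ) → Odd n → (a b : ℕ) → 1 ≤ a → a ≤ n + 2 → 1 ≤ b → b ≤ n + 2 → a ≢ b →
    (w : List ℕ) → H n w →
    H (n + 2) (φ a b w) ⊎ ¬ Symmetric (shape (Qtab (φ a b w)))
lemma3p10 n _ a b 1≤a a≤n+2 1≤b b≤n+2 a≢b w (w-perm , (k , _ , k≤n , shape-w) , symmetric-w)
  with ≡-dec _≟_ (conj (shape (Qtab (φ a b w)))) (shape (Qtab (φ a b w)))
... | no ¬symmetric = inj₂ ¬symmetric
... | yes symmetric = inj₁ (φ-isPerm n a b w 1≤a a≤n+2 1≤b b≤n+2 a≢b w-perm , hook , symmetric)
  where
  Qφ = Qtab (φ a b w)
  n+2≡1+k+k : n + 2 ≡ suc (k + k)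
  n+2≡1+k+k = trans (+-comm n 2) (cong suc (sym (symmetricHook⇒k+k≡1+n n k k≤n (subst Symmetric shape-w symmetric-w))))
  size : sum (shape Qφ) ≡ suc (k + k)
  size = trans (size-Qtab (φ a b w)) (trans (length-φ a b w) (trans (cong (_+ 2) (IsPerm⇒length w w-perm)) n+2≡1+k+k))
  k≤firstRow : k ≤ length (firstRow Qφ)
  k≤firstRow = subst (_≤ length (firstRow Qφ)) (length-firstRow≡head (Qtab w) shape-w) (length-firstRow-Qtab-φ a b w)
  hook : Hook (n + 2) (shape Qφ)
  hook = subst₂ Hook (sym n+2≡1+k+k) (sym (symmetric-shape⇒hook k Qφ symmetric size k≤firstRow)) (hook-shape k)
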